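{- Let $G$ be a directed graph with root $r$ and terminals $T$, let $\hat G\subseteq G$ be rooted $\ell$-connected, $E_+=E(G)\setminus E(\hat G)$, and let $C$ be a core of $\hat G$. Let $x\in[0,1]^{E_+}$ be a minimal fractional cover of $\mathsf{Halo}(C)$, i.e., $\sum_{e\in\delta^{in}_{E_+}(U)}x_e\ge1$ for all $U\in\mathsf{Halo}(C)$, and decreasing the value $x_e$ of any edge $e\in E_+$ (with $x_e>0$) results in a vector violating one of these constraints. Then $\sum_{e\in\delta^{in}_{E_+}(H(C))}x_e=1$. In particular, if $x$ is the indicator vector of an edge set $E'$, then exactly one edge of $E'$ enters $H(C)$.
   Context: $\hat G$ is rooted $\ell$-connected if it contains $\ell$ edge-disjoint $r\to t$ paths for each $t\in T\subseteq V\setminus\{r\}$. $\delta^{in}_{F}(U)$ is the set of edges of $F$ with head in $U$ and tail outside $U$. A deficient set is $U\subseteq V$ with $r\notin U$, $U\cap T\ne\emptyset$ and $|\delta^{in}_{\hat G}(U)|=\ell$. A core is a deficient set properly containing no other deficient set; $\mathsf{Halo}(C)$ is the family of deficient sets containing core $C$ and no other core; $H(C)=\bigcup_{U\in\mathsf{Halo}(C)}U$. -}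

module Defs where

open import Data.Nat using (ℕ)
open import Data.Fin using (Fin)
open import Data.Fin.Subset using (Subset; _∈_; _∉_; _⊆_)
open import Data.Fin.Subset.Properties using (_∈?_)
open import Data.List using (List; []; _∷_; length; lookup; allFin; filter; concatMap; foldr; map)
open import Data.List.Relation.Unary.Unique.Propositional using (Unique)
open import Data.Product using (Σ; _×_; _,_; proj₁; proj₂)
open import Data.Rational using (ℚ; 0ℚ; 1ℚ; _+_; _≤_; _<_)
open import Data.Fin using (_≟_)
open import Relation.Nullary.Decidable using (does)
open import Data.Bool using (if_then_else_)
open import Relation.Binary.PropositionalEquality using (_≡_)
open import Relation.Nullary using (¬_)
open import Relation.Nullary.Decidable using (_×-dec_; ¬?)
open import Relation.Unary using (Decidable)

-- A directed (multi)graph on vertex set Fin n is a list of edges;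
-- an edge is a pair (tail , head).
Edge : ℕ → Set
Edge n = Fin n × Fin n

EdgeList : ℕ → Set
EdgeList n = List (Edge n)

EdgeId : ∀ {n} → EdgeList n → Set
EdgeId E = Fin (length E)

tl hd : ∀ {n} (E : EdgeList n) → EdgeId E → Fin n
tl E e = proj₁ (lookup E e)
hd E e = proj₂ (lookup E e)

data Walk {n} (E : EdgeList n) : Fin n → Fin n → Set where
  []  : ∀ {v} → Walk E v v
  step : ∀ {u v} (e : EdgeId E) → tl E e ≡ u → Walk E (hd E e) v → Walk E u v

walkEdges : ∀ {n} {E : EdgeList n} {u v} → Walk E u v → List (EdgeId E)
walkEdges []           = []
walkEdges (step e _ w) = e ∷ walkEdges w

walkVertices : ∀ {n} {E : EdgeList n} {u v} → Walk E u v → List (Fin n)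
walkVertices {u = u} []   = u ∷ []
walkVertices {u = u} (step e _ w) = u ∷ walkVertices w

Path : ∀ {n} (E : EdgeList n) → Fin n → Fin n → Set
Path E u v = Σ (Walk E u v) λ w → Unique (walkVertices w)

RootedConnected : ∀ {n} (E : EdgeList n) (r : Fin n) (Term : Subset n) (ℓ : ℕ) → Set
RootedConnected E r Term ℓ =
  ∀ t → t ∈ Term →
    Σ (Fin ℓ → Path E r t) λ ps →
      Unique (concatMap (λ i → walkEdges (proj₁ (ps i))) (allFin ℓ))

Enters : ∀ {n} (E : EdgeList n) → Subset n → EdgeId E → Set
Enters E U e = hd E e ∈ U × tl E e ∉ U

enters? : ∀ {n} (E : EdgeList n) (U : Subset n) → Decidable (Enters E U)
enters? E U e = (hd E e ∈? U) ×-dec ¬? (tl E e ∈? U)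

δin : ∀ {n} (E : EdgeList n) → Subset n → List (EdgeId E)
δin E U = filter (enters? E U) (allFin (length E))

sumℚ : List ℚ → ℚ
sumℚ = foldr _+_ 0ℚ

inSum : ∀ {n} (E : EdgeList n) → (EdgeId E → ℚ) → Subset n → ℚ
inSum E x U = sumℚ (map x (δin E U))

Deficient : ∀ {n} (Ĝ : EdgeList n) (r : Fin n) (Term : Subset n) (ℓ : ℕ) → Subset n → Set
Deficient Ĝ r Term ℓ U =
  r ∉ U × Σ (Fin _) (λ t → t ∈ U × t ∈ Term) × length (δin Ĝ U) ≡ ℓ

Core : ∀ {n} (Ĝ : EdgeList n) (r : Fin n) (Term : Subset n) (ℓ : ℕ) → Subset n → Set
Core Ĝ r Term ℓ C =
  Deficient Ĝ r Term ℓ C × (∀ U → Deficient Ĝ r Term ℓ U → U ⊆ C → U ≡ C)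

Halo : ∀ {n} (Ĝ : EdgeList n) (r : Fin n) (Term : Subset n) (ℓ : ℕ) → Subset n → Subset n → Set
Halo Ĝ r Term ℓ C U =
  Deficient Ĝ r Term ℓ U × C ⊆ U ×
  (∀ C' → Core Ĝ r Term ℓ C' → C' ⊆ U → C' ≡ C)

IsHaloUnion : ∀ {n} (Ĝ : EdgeList n) (r : Fin n) (Term : Subset n) (ℓ : ℕ) → Subset n → Subset n → Set
IsHaloUnion Ĝ r Term ℓ C H =
  ∀ v → (v ∈ H → Σ (Subset _) λ U → Halo Ĝ r Term ℓ C U × v ∈ U)
      × (∀ U → Halo Ĝ r Term ℓ C U → v ∈ U → v ∈ H)

InUnitCube : ∀ {m} → (Fin m → ℚ) → Set
InUnitCube x = ∀ e → 0ℚ ≤ x e × x e ≤ 1ℚ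

FracCoverHalo : ∀ {n} (Ĝ E₊ : EdgeList n) (r : Fin n) (Term : Subset n) (ℓ : ℕ)
  (C : Subset n) → (EdgeId E₊ → ℚ) → Set
FracCoverHalo Ĝ E₊ r Term ℓ C x =
  ∀ U → Halo Ĝ r Term ℓ C U → 1ℚ ≤ inSum E₊ x U

updateAt : ∀ {m} → (Fin m → ℚ) → Fin m → ℚ → Fin m → ℚ
updateAt x e q f = if does (f ≟ e) then q else x f

MinimalFracCoverHalo : ∀ {n} (Ĝ E₊ : EdgeList n) (r : Fin n) (Term : Subset n) (ℓ : ℕ)
  (C : Subset n) → (EdgeId E₊ → ℚ) → Set
MinimalFracCoverHalo Ĝ E₊ r Term ℓ C x =
  InUnitCube x × FracCoverHalo Ĝ E₊ r Term ℓ C x ×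
  (∀ e → 0ℚ < x e → ∀ q → 0ℚ ≤ q → q < x e →
     Σ (Subset _) λ U → Halo Ĝ r Term ℓ C U × inSum E₊ (updateAt x e q) U < 1ℚ)

IsIndicator : ∀ {m} → Subset m → (Fin m → ℚ) → Set
IsIndicator E' x = ∀ e → x e ≡ (if does (e ∈? E') then 1ℚ else 0ℚ)

-- Every set U with r ∉ U containing a terminal has in-degree at least ℓ in Ĝ (each of the ℓ
-- edge-disjoint r→t paths enters U), so by submodularity of in-degree two deficient sets sharing
-- a terminal have deficient union and intersection. Hence Halo(C) is closed under ∪ and ∩, and
-- H, the union of the finite family Halo(C), belongs to it; so x(δ^in H) ≥ 1.
-- Conversely, minimality of x gives, for each edge e entering H with x_e > 0 and each ε > 0, a
-- set of Halo(C) entered by e with x(δ^in U) < 1 + ε. Since x(δ^in ·) is submodular and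
-- x(δ^in (A ∩ B)) ≥ 1, the union of two halo sets with excesses a and b has excess below a + b.
-- The union W of such sets for all these edges, with excesses ε/2, ε/4, …, thus has
-- x(δ^in W) < 1 + ε, and every edge of δ^in H carrying weight enters W ⊆ H. So x(δ^in H) ≤ 1.

{-# OPTIONS --safe #-}
module Submission where

open import Defs
open import Data.Nat using (ℕ)
open import Data.Fin using (Fin)
open import Data.Fin.Subset using (Subset; _∈_; _∉_)
open import Data.Fin.Subset.Properties using (_∈?_)
open import Data.List using (length; filter)
open import Data.Product using (_×_)
open import Data.Rational using (ℚ; 1ℚ)
open import Relation.Binary.PropositionalEquality using (_≡_)

import Data.Nat as ℕ
import Data.Nat.Properties as ℕ
open import Data.Nat using (zero; suc; z≤n; s≤s)
open import Data.Bool using (true; false; _∧_; _∨_; not; if_then_else_)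
open import Data.Empty using (⊥-elim)
open import Data.Sum using (_⊎_; inj₁; inj₂; [_,_]′)
open import Data.Product using (Σ; _,_; proj₁; proj₂)
open import Data.Fin using (_≟_)
import Data.Fin as Fin
open import Data.Fin.Properties using (injective⇒≤)
open import Data.Fin.Subset using (_⊆_; _∪_; _∩_)
open import Data.Fin.Subset.Properties
  using (x∈p∩q⁺; x∈p∩q⁻; x∈p∪q⁻; p⊆p∪q; q⊆p∪q; p∩q⊆p; ⊆-antisym)
open import Data.Vec using (_∷_; lookup)
open import Data.Vec.Properties using (lookup-zipWith)
open import Data.List using (List; []; _∷_; _++_; map; allFin; concatMap)
open import Data.List.Membership.Propositional using () renaming (_∈_ to _∈ₗ_; _∉_ to _∉ₗ_)
open import Data.List.Membership.Propositional.Properties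
  using (∈-filter⁺; ∈-filter⁻; ∈-allFin; ∈-++⁺ʳ; ∈-map⁺; ∈-concat⁺′)
import Data.List.Membership.Setoid.Properties as Membershipₛ
open import Data.List.Relation.Unary.Any using (here; there; index)
import Data.List.Relation.Unary.All as All
open import Data.List.Relation.Unary.AllPairs using ([]; _∷_)
open import Data.List.Relation.Unary.Unique.Propositional using (Unique)
open import Data.List.Relation.Unary.Unique.Propositional.Properties using (filter⁺; allFin⁺)
open import Data.Rational using (0ℚ; ½; _+_; _*_; -_; _-_; _≤_; _<_)
open import Data.Rational.Properties
  using ( ≤-refl; ≤-reflexive; ≤-antisym; <⇒≤; ≮⇒≥; ≰⇒>; <-irrefl; ≤-<-trans; _≤?_; _<?_
        ; +-assoc; +-comm; +-identityˡ; +-identityʳ; +-inverseʳ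
        ; +-mono-≤; +-monoˡ-≤; +-monoʳ-≤; +-monoˡ-<; +-monoʳ-<; +-mono-<-≤
        ; *-distribˡ-+; *-identityʳ; positive⁻¹; pos*pos⇒pos; module ≤-Reasoning)
open import Data.Rational.Base using (positive)
open import Data.Rational.Solver using (module +-*-Solver)
open import Relation.Binary.PropositionalEquality
  using (_≢_; refl; sym; trans; cong; cong₂; subst; subst₂; setoid; module ≡-Reasoning)
open import Relation.Nullary using (¬_; Dec; yes; no)
open import Relation.Nullary.Decidable using (does; dec-true; dec-false; _×-dec_)
open import Relation.Unary using (Decidable)
open import Function using (id; _∘_)

module _ where
  open +-*-Solver

  private
    p+r-r≡p : ∀ p r → (p + r) - r ≡ p
    p+r-r≡p = solve 2 (λ p r → (p :+ r) :+ (:- r) := p) refl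

    -r+[r+p]≡p : ∀ r p → - r + (r + p) ≡ p
    -r+[r+p]≡p = solve 2 (λ r p → (:- r) :+ (r :+ p) := p) refl

    p-r+r≡p : ∀ p r → (p - r) + r ≡ p
    p-r+r≡p = solve 2 (λ p r → (p :+ (:- r)) :+ r := p) refl

    q+[p-q]≡p : ∀ q p → q + (p - q) ≡ p
    q+[p-q]≡p = solve 2 (λ q p → q :+ (p :+ (:- q)) := p) refl

  +-cancelʳ-< : ∀ {p q} r → p + r < q + r → p < q
  +-cancelʳ-< {p} {q} r p+r<q+r =
    subst₂ _<_ (p+r-r≡p p r) (p+r-r≡p q r) (+-monoˡ-< (- r) p+r<q+r)

  +-cancelˡ-≤ : ∀ r {p q} → r + p ≤ r + q → p ≤ q
  +-cancelˡ-≤ r {p} {q} r+p≤r+q = begin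
    p               ≡⟨ sym (-r+[r+p]≡p r p) ⟩
    - r + (r + p)   ≤⟨ +-monoʳ-≤ (- r) r+p≤r+q ⟩
    - r + (r + q)   ≡⟨ -r+[r+p]≡p r q ⟩
    q               ∎
    where open ≤-Reasoning

  <+ε⇒≤ : ∀ {p q} → (∀ ε → 0ℚ < ε → p < q + ε) → p ≤ q
  <+ε⇒≤ {p} {q} p<q+ε = ≮⇒≥ λ q<p → <-irrefl refl (begin-strict
    p               <⟨ p<q+ε (p - q) (0<p-q q<p) ⟩
    q + (p - q)     ≡⟨ q+[p-q]≡p q p ⟩
    p               ∎)
    where
      open ≤-Reasoning
      0<p-q : q < p → 0ℚ < p - q
      0<p-q q<p = subst (_< p - q) (+-inverseʳ q) (+-monoˡ-< (- q) q<p)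

  ∃-below-within : ∀ {p ε} → 0ℚ < p → 0ℚ < ε → Σ ℚ λ q → 0ℚ ≤ q × q < p × p ≤ q + ε
  ∃-below-within {p} {ε} 0<p 0<ε with p ≤? ε
  ... | yes p≤ε = 0ℚ , ≤-refl , 0<p , subst (p ≤_) (sym (+-identityˡ ε)) p≤ε
  ... | no p≰ε = p - ε , 0≤p-ε , p-ε<p , ≤-reflexive (sym (p-r+r≡p p ε))
    where
      open ≤-Reasoning
      0≤p-ε : 0ℚ ≤ p - ε
      0≤p-ε = subst (_≤ p - ε) (+-inverseʳ ε) (+-monoˡ-≤ (- ε) (<⇒≤ (≰⇒> p≰ε)))
      p-ε<p : p - ε < p
      p-ε<p = +-cancelʳ-< ε (begin-strict
        (p - ε) + ε   ≡⟨ p-r+r≡p p ε ⟩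
        p             ≡⟨ sym (+-identityʳ p) ⟩
        p + 0ℚ        <⟨ +-monoʳ-< p 0<ε ⟩
        p + ε         ∎)

  half-pos : ∀ {ε} → 0ℚ < ε → 0ℚ < ε * ½
  half-pos {ε} 0<ε = positive⁻¹ (ε * ½) {{pos*pos⇒pos ε {{positive 0<ε}} ½}}

  half+half : ∀ ε → ε * ½ + ε * ½ ≡ ε
  half+half ε = trans (sym (*-distribˡ-+ ε ½ ½)) (*-identityʳ ε)

  0<1 : 0ℚ < 1ℚ
  0<1 = positive⁻¹ 1ℚ

fromℕ : ℕ → ℚ
fromℕ zero    = 0ℚ
fromℕ (suc k) = 1ℚ + fromℕ k

fromℕ-nonNeg : ∀ k → 0ℚ ≤ fromℕ k
fromℕ-nonNeg zero    = ≤-refl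
fromℕ-nonNeg (suc k) = +-mono-≤ (<⇒≤ 0<1) (fromℕ-nonNeg k)

fromℕ-+ : ∀ m n → fromℕ (m ℕ.+ n) ≡ fromℕ m + fromℕ n
fromℕ-+ zero    n = sym (+-identityˡ (fromℕ n))
fromℕ-+ (suc m) n = trans (cong (1ℚ +_) (fromℕ-+ m n)) (sym (+-assoc 1ℚ (fromℕ m) (fromℕ n)))

fromℕ-cancel-≤ : ∀ {m n} → fromℕ m ≤ fromℕ n → m ℕ.≤ n
fromℕ-cancel-≤ {zero}          _  = z≤n
fromℕ-cancel-≤ {suc m} {zero}  le = ⊥-elim (<-irrefl refl (≤-<-trans le 0<1+m))
  where 0<1+m = +-mono-<-≤ 0<1 (fromℕ-nonNeg m)
fromℕ-cancel-≤ {suc m} {suc n} le = s≤s (fromℕ-cancel-≤ (+-cancelˡ-≤ 1ℚ le))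

fromℕ-injective : ∀ {m n} → fromℕ m ≡ fromℕ n → m ≡ n
fromℕ-injective eq =
  ℕ.≤-antisym (fromℕ-cancel-≤ (≤-reflexive eq)) (fromℕ-cancel-≤ (≤-reflexive (sym eq)))

module _ {A : Set} where

  sumℚ-map-cong : ∀ {f g : A → ℚ} xs → (∀ {a} → a ∈ₗ xs → f a ≡ g a) →
    sumℚ (map f xs) ≡ sumℚ (map g xs)
  sumℚ-map-cong []       _   = refl
  sumℚ-map-cong (a ∷ xs) f≡g = cong₂ _+_ (f≡g (here refl)) (sumℚ-map-cong xs (f≡g ∘ there))

  sumℚ-map-mono : ∀ {f g : A → ℚ} xs → (∀ {a} → a ∈ₗ xs → f a ≤ g a) →
    sumℚ (map f xs) ≤ sumℚ (map g xs)
  sumℚ-map-mono []       _   = ≤-refl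
  sumℚ-map-mono (a ∷ xs) f≤g = +-mono-≤ (f≤g (here refl)) (sumℚ-map-mono xs (f≤g ∘ there))

  sumℚ-map-+ : ∀ (f g : A → ℚ) xs →
    sumℚ (map (λ a → f a + g a) xs) ≡ sumℚ (map f xs) + sumℚ (map g xs)
  sumℚ-map-+ f g []       = refl
  sumℚ-map-+ f g (a ∷ xs) = trans (cong (f a + g a +_) (sumℚ-map-+ f g xs))
    (interchange (f a) (g a) (sumℚ (map f xs)) (sumℚ (map g xs)))
    where
      open +-*-Solver
      interchange : ∀ p q r s → (p + q) + (r + s) ≡ (p + r) + (q + s)
      interchange = solve 4 (λ p q r s → (p :+ q) :+ (r :+ s) := (p :+ r) :+ (q :+ s)) refl

  sumℚ-map-0 : ∀ (xs : List A) → sumℚ (map (λ _ → 0ℚ) xs) ≡ 0ℚ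
  sumℚ-map-0 []       = refl
  sumℚ-map-0 (a ∷ xs) = trans (+-identityˡ _) (sumℚ-map-0 xs)

  sumℚ-map-1 : ∀ (xs : List A) → sumℚ (map (λ _ → 1ℚ) xs) ≡ fromℕ (length xs)
  sumℚ-map-1 []       = refl
  sumℚ-map-1 (a ∷ xs) = cong (1ℚ +_) (sumℚ-map-1 xs)

  sumℚ-filter : ∀ {P : A → Set} (P? : Decidable P) (w : A → ℚ) xs →
    sumℚ (map w (filter P? xs)) ≡ sumℚ (map (λ a → if does (P? a) then w a else 0ℚ) xs)
  sumℚ-filter P? w []       = refl
  sumℚ-filter P? w (a ∷ xs) with does (P? a)
  ... | true  = cong (w a +_) (sumℚ-filter P? w xs)
  ... | false = trans (sumℚ-filter P? w xs) (sym (+-identityˡ _))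

sumℚ-indicator : ∀ {m} {x : Fin m → ℚ} (E' : Subset m) → IsIndicator E' x →
  ∀ es → sumℚ (map x es) ≡ fromℕ (length (filter (_∈? E') es))
sumℚ-indicator {x = x} E' indicator es = begin
  sumℚ (map x es)                                          ≡⟨ sumℚ-map-cong es (λ {e} _ → indicator e) ⟩
  sumℚ (map (λ e → if does (e ∈? E') then 1ℚ else 0ℚ) es)  ≡⟨ sym (sumℚ-filter (_∈? E') (λ _ → 1ℚ) es) ⟩
  sumℚ (map (λ _ → 1ℚ) (filter (_∈? E') es))               ≡⟨ sumℚ-map-1 (filter (_∈? E') es) ⟩
  fromℕ (length (filter (_∈? E') es))                      ∎
  where open ≡-Reasoning

module _ {m} (x : Fin m → ℚ) (e : Fin m) (q : ℚ) where

  updateAt-≡ : updateAt x e q e ≡ q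
  updateAt-≡ rewrite dec-true (e ≟ e) refl = refl

  updateAt-≢ : ∀ {f} → f ≢ e → updateAt x e q f ≡ x f
  updateAt-≢ {f} f≢e rewrite dec-false (f ≟ e) f≢e = refl

  sumℚ-updateAt-∉ : ∀ xs → e ∉ₗ xs → sumℚ (map (updateAt x e q) xs) ≡ sumℚ (map x xs)
  sumℚ-updateAt-∉ xs e∉xs = sumℚ-map-cong xs λ f∈xs → updateAt-≢ λ { refl → e∉xs f∈xs }

  sumℚ-updateAt-∈ : ∀ {xs} → Unique xs → e ∈ₗ xs →
    sumℚ (map (updateAt x e q) xs) + x e ≡ sumℚ (map x xs) + q
  sumℚ-updateAt-∈ {e ∷ xs} (e∉xs ∷ _) (here refl) = begin
    (updateAt x e q e + sumℚ (map (updateAt x e q) xs)) + x e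
      ≡⟨ cong₂ (λ a b → (a + b) + x e) updateAt-≡
               (sumℚ-updateAt-∉ xs λ e∈xs → All.lookup e∉xs e∈xs refl) ⟩
    (q + sumℚ (map x xs)) + x e
      ≡⟨ swap q (sumℚ (map x xs)) (x e) ⟩
    (x e + sumℚ (map x xs)) + q ∎
    where
      open ≡-Reasoning
      open +-*-Solver
      swap : ∀ a s b → (a + s) + b ≡ (b + s) + a
      swap = solve 3 (λ a s b → (a :+ s) :+ b := (b :+ s) :+ a) refl
  sumℚ-updateAt-∈ {f ∷ xs} (f∉xs ∷ unique) (there e∈xs) = begin
    (updateAt x e q f + sumℚ (map (updateAt x e q) xs)) + x e
      ≡⟨ +-assoc (updateAt x e q f) _ (x e) ⟩
    updateAt x e q f + (sumℚ (map (updateAt x e q) xs) + x e)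
      ≡⟨ cong₂ _+_ (updateAt-≢ (All.lookup f∉xs e∈xs)) (sumℚ-updateAt-∈ unique e∈xs) ⟩
    x f + (sumℚ (map x xs) + q)
      ≡⟨ sym (+-assoc (x f) _ q) ⟩
    (x f + sumℚ (map x xs)) + q ∎
    where open ≡-Reasoning

does-∈ : ∀ {n} (v : Fin n) (p : Subset n) → does (v ∈? p) ≡ lookup p v
does-∈ Fin.zero    (true  ∷ p) = refl
does-∈ Fin.zero    (false ∷ p) = refl
does-∈ (Fin.suc v) (_     ∷ p) = does-∈ v p

-- hA, hB (tA, tB) record whether the head (tail) of an edge lies in A, B.
enters-weight-submodular : ∀ {w} → 0ℚ ≤ w → ∀ hA hB tA tB →
  (if (hA ∨ hB) ∧ not (tA ∨ tB) then w else 0ℚ) + (if (hA ∧ hB) ∧ not (tA ∧ tB) then w else 0ℚ)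
    ≤ (if hA ∧ not tA then w else 0ℚ) + (if hB ∧ not tB then w else 0ℚ)
enters-weight-submodular     _   false false false false = ≤-refl
enters-weight-submodular     _   false false false true  = ≤-refl
enters-weight-submodular     _   false false true  false = ≤-refl
enters-weight-submodular     _   false false true  true  = ≤-refl
enters-weight-submodular {w} _   false true  false false = ≤-reflexive (+-comm w 0ℚ)
enters-weight-submodular     _   false true  false true  = ≤-refl
enters-weight-submodular     0≤w false true  true  false = +-monoʳ-≤ 0ℚ 0≤w
enters-weight-submodular     _   false true  true  true  = ≤-refl
enters-weight-submodular     _   true  false false false = ≤-refl
enters-weight-submodular     0≤w true  false false true  = +-monoˡ-≤ 0ℚ 0≤w
enters-weight-submodular     _   true  false true  false = ≤-refl
enters-weight-submodular     _   true  false true  true  = ≤-refl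
enters-weight-submodular     _   true  true  false false = ≤-refl
enters-weight-submodular {w} _   true  true  false true  = ≤-reflexive (+-comm 0ℚ w)
enters-weight-submodular     _   true  true  true  false = ≤-refl
enters-weight-submodular     _   true  true  true  true  = ≤-refl

module _ {n} (E : EdgeList n) where

  does-enters : ∀ U e → does (enters? E U e) ≡ lookup U (hd E e) ∧ not (lookup U (tl E e))
  does-enters U e rewrite does-∈ (hd E e) U | does-∈ (tl E e) U = refl

  δin-unique : ∀ U → Unique (δin E U)
  δin-unique U = filter⁺ (enters? E U) (allFin⁺ (length E))

  ∈-δin⁺ : ∀ {U e} → Enters E U e → e ∈ₗ δin E U
  ∈-δin⁺ {U} {e} = ∈-filter⁺ (enters? E U) (∈-allFin e)

  ∈-δin⁻ : ∀ {U e} → e ∈ₗ δin E U → Enters E U e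
  ∈-δin⁻ {U} = proj₂ ∘ ∈-filter⁻ (enters? E U) {xs = allFin (length E)}

  inSum-as-sum : ∀ w U →
    inSum E w U ≡ sumℚ (map (λ e → if does (enters? E U e) then w e else 0ℚ) (allFin (length E)))
  inSum-as-sum w U = sumℚ-filter (enters? E U) w (allFin (length E))

  module _ (A B : Subset n) where

    inSum-submodular : ∀ w → (∀ e → 0ℚ ≤ w e) →
      inSum E w (A ∪ B) + inSum E w (A ∩ B) ≤ inSum E w A + inSum E w B
    inSum-submodular w 0≤w = begin
      inSum E w (A ∪ B) + inSum E w (A ∩ B)
        ≡⟨ cong₂ _+_ (inSum-as-sum w (A ∪ B)) (inSum-as-sum w (A ∩ B)) ⟩
      Σ[ A ∪ B ] + Σ[ A ∩ B ]
        ≡⟨ sym (sumℚ-map-+ (weight (A ∪ B)) (weight (A ∩ B)) edges) ⟩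
      sumℚ (map (λ e → weight (A ∪ B) e + weight (A ∩ B) e) edges)
        ≤⟨ sumℚ-map-mono edges (λ {e} _ → pointwise e) ⟩
      sumℚ (map (λ e → weight A e + weight B e) edges)
        ≡⟨ sumℚ-map-+ (weight A) (weight B) edges ⟩
      Σ[ A ] + Σ[ B ]
        ≡⟨ sym (cong₂ _+_ (inSum-as-sum w A) (inSum-as-sum w B)) ⟩
      inSum E w A + inSum E w B ∎
      where
        open ≤-Reasoning
        edges = allFin (length E)
        weight : Subset n → EdgeId E → ℚ
        weight U e = if does (enters? E U e) then w e else 0ℚ
        Σ[_] : Subset n → ℚ
        Σ[ U ] = sumℚ (map (weight U) edges)
        pointwise : ∀ e → weight (A ∪ B) e + weight (A ∩ B) e ≤ weight A e + weight B e
        pointwise e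
          rewrite does-enters (A ∪ B) e | does-enters (A ∩ B) e | does-enters A e | does-enters B e
                | lookup-zipWith _∨_ (hd E e) A B | lookup-zipWith _∨_ (tl E e) A B
                | lookup-zipWith _∧_ (hd E e) A B | lookup-zipWith _∧_ (tl E e) A B
          = enters-weight-submodular (0≤w e)
              (lookup A (hd E e)) (lookup B (hd E e)) (lookup A (tl E e)) (lookup B (tl E e))

    δin-length-submodular :
      length (δin E (A ∪ B)) ℕ.+ length (δin E (A ∩ B)) ℕ.≤ length (δin E A) ℕ.+ length (δin E B)
    δin-length-submodular = fromℕ-cancel-≤ (begin
      fromℕ (d (A ∪ B) ℕ.+ d (A ∩ B))  ≡⟨ fromℕ-+ (d (A ∪ B)) (d (A ∩ B)) ⟩
      fromℕ (d (A ∪ B)) + fromℕ (d (A ∩ B))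
        ≡⟨ sym (cong₂ _+_ (sumℚ-map-1 (δin E (A ∪ B))) (sumℚ-map-1 (δin E (A ∩ B)))) ⟩
      inSum E one (A ∪ B) + inSum E one (A ∩ B)  ≤⟨ inSum-submodular one (λ _ → <⇒≤ 0<1) ⟩
      inSum E one A + inSum E one B  ≡⟨ cong₂ _+_ (sumℚ-map-1 (δin E A)) (sumℚ-map-1 (δin E B)) ⟩
      fromℕ (d A) + fromℕ (d B)  ≡⟨ sym (fromℕ-+ (d A) (d B)) ⟩
      fromℕ (d A ℕ.+ d B) ∎)
      where
        open ≤-Reasoning
        d : Subset n → ℕ
        d U = length (δin E U)
        one : EdgeId E → ℚ
        one _ = 1ℚ

  inSum-mono-support : ∀ {w U W} → (∀ e → 0ℚ ≤ w e) →
    (∀ {e} → Enters E U e → 0ℚ < w e → Enters E W e) → inSum E w U ≤ inSum E w W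
  inSum-mono-support {w} {U} {W} 0≤w U⇒W = begin
    inSum E w U      ≡⟨ inSum-as-sum w U ⟩
    sumℚ (map (weight U) edges)   ≤⟨ sumℚ-map-mono edges (λ {e} _ → pointwise e) ⟩
    sumℚ (map (weight W) edges)   ≡⟨ sym (inSum-as-sum w W) ⟩
    inSum E w W ∎
    where
      open ≤-Reasoning
      edges = allFin (length E)
      weight : Subset n → EdgeId E → ℚ
      weight V e = if does (enters? E V e) then w e else 0ℚ
      pointwise : ∀ e → weight U e ≤ weight W e
      pointwise e = by-cases (enters? E U e) (enters? E W e)
        where
          by-cases : (e∈δU? : Dec (Enters E U e)) (e∈δW? : Dec (Enters E W e)) →
            (if does e∈δU? then w e else 0ℚ) ≤ (if does e∈δW? then w e else 0ℚ)
          by-cases (yes _)    (yes _)    = ≤-refl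
          by-cases (no  _)    (yes _)    = 0≤w e
          by-cases (no  _)    (no  _)    = ≤-refl
          by-cases (yes e∈δU) (no  e∉δW) = ≮⇒≥ λ 0<we → e∉δW (U⇒W e∈δU 0<we)

  inSum-nonPos : ∀ {w U} → (∀ {e} → Enters E U e → ¬ 0ℚ < w e) → inSum E w U ≤ 0ℚ
  inSum-nonPos {w} {U} unweighted = begin
    inSum E w U                      ≤⟨ sumℚ-map-mono (δin E U) (≮⇒≥ ∘ unweighted ∘ ∈-δin⁻) ⟩
    sumℚ (map (λ _ → 0ℚ) (δin E U))  ≡⟨ sumℚ-map-0 (δin E U) ⟩
    0ℚ ∎
    where open ≤-Reasoning

-- Edge-disjoint paths and the in-degree bound

walk-enters : ∀ {n} {E : EdgeList n} {U u v} (p : Walk E u v) → u ∉ U → v ∈ U →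
  Σ (EdgeId E) λ e → e ∈ₗ walkEdges p × Enters E U e
walk-enters []                  u∉U u∈U = ⊥-elim (u∉U u∈U)
walk-enters {E = E} {U} (step e refl p) u∉U v∈U with hd E e ∈? U
... | yes hd∈U = e , here refl , hd∈U , u∉U
... | no  hd∉U with walk-enters p hd∉U v∈U
...   | f , f∈p , f∈δU = f , there f∈p , f∈δU

module _ {A : Set} where

  unique-++-disjoint : ∀ xs {ys} {a : A} → Unique (xs ++ ys) → a ∈ₗ xs → a ∉ₗ ys
  unique-++-disjoint (x ∷ xs) (x∉ ∷ _)      (here refl) a∈ys = All.lookup x∉ (∈-++⁺ʳ xs a∈ys) refl
  unique-++-disjoint (x ∷ xs) (_ ∷ unique) (there a∈xs)    = unique-++-disjoint xs unique a∈xs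

  unique-++ʳ : ∀ xs {ys : List A} → Unique (xs ++ ys) → Unique ys
  unique-++ʳ []       unique       = unique
  unique-++ʳ (x ∷ xs) (_ ∷ unique) = unique-++ʳ xs unique

  unique-concatMap-disjoint : ∀ {I : Set} (g : I → List A) {ks a i j} → Unique (concatMap g ks) →
    i ∈ₗ ks → j ∈ₗ ks → a ∈ₗ g i → a ∈ₗ g j → i ≡ j
  unique-concatMap-disjoint g {k ∷ ks} unique (here refl) (here refl) _ _ = refl
  unique-concatMap-disjoint g {k ∷ ks} unique (here refl) (there j∈ks) a∈gk a∈gj =
    ⊥-elim (unique-++-disjoint (g k) unique a∈gk (∈-concat⁺′ a∈gj (∈-map⁺ g j∈ks)))
  unique-concatMap-disjoint g {k ∷ ks} unique (there i∈ks) (here refl) a∈gi a∈gk =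
    ⊥-elim (unique-++-disjoint (g k) unique a∈gk (∈-concat⁺′ a∈gi (∈-map⁺ g i∈ks)))
  unique-concatMap-disjoint g {k ∷ ks} unique (there i∈ks) (there j∈ks) =
    unique-concatMap-disjoint g (unique-++ʳ (g k) unique) i∈ks j∈ks

rootedConnected⇒ℓ≤δin : ∀ {n} {Ĝ : EdgeList n} {r Term ℓ} → RootedConnected Ĝ r Term ℓ →
  ∀ {U t} → r ∉ U → t ∈ U → t ∈ Term → ℓ ℕ.≤ length (δin Ĝ U)
rootedConnected⇒ℓ≤δin {Ĝ = Ĝ} {ℓ = ℓ} rc {U} {t} r∉U t∈U t∈T = injective⇒≤ crossing-injective
  where
    paths = proj₁ (rc t t∈T)
    edges : Fin ℓ → List (EdgeId Ĝ)
    edges i = walkEdges (proj₁ (paths i))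
    crossing : ∀ i → Σ (EdgeId Ĝ) λ e → e ∈ₗ edges i × Enters Ĝ U e
    crossing i = walk-enters (proj₁ (paths i)) r∉U t∈U
    crossing∈δin : ∀ i → proj₁ (crossing i) ∈ₗ δin Ĝ U
    crossing∈δin i = ∈-δin⁺ Ĝ (proj₂ (proj₂ (crossing i)))
    crossing-injective : ∀ {i j} → index (crossing∈δin i) ≡ index (crossing∈δin j) → i ≡ j
    crossing-injective {i} {j} same-index =
      unique-concatMap-disjoint edges (proj₂ (rc t t∈T)) (∈-allFin i) (∈-allFin j)
        (proj₁ (proj₂ (crossing i))) (subst (_∈ₗ edges j) (sym same-edge) (proj₁ (proj₂ (crossing j))))
      where
        same-edge : proj₁ (crossing i) ≡ proj₁ (crossing j)
        same-edge = Membershipₛ.index-injective (setoid _) (crossing∈δin i) (crossing∈δin j) same-index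

-- Uncrossing deficient sets; the lattice Halo(C)

squeeze-+ : ∀ {a b ℓ} → a ℕ.+ b ℕ.≤ ℓ ℕ.+ ℓ → ℓ ℕ.≤ a → ℓ ℕ.≤ b → a ≡ ℓ × b ≡ ℓ
squeeze-+ {a} {b} {ℓ} a+b≤ℓ+ℓ ℓ≤a ℓ≤b =
  ℕ.≤-antisym (ℕ.+-cancelʳ-≤ ℓ a ℓ (ℕ.≤-trans (ℕ.+-monoʳ-≤ a ℓ≤b) a+b≤ℓ+ℓ)) ℓ≤a ,
  ℕ.≤-antisym (ℕ.+-cancelˡ-≤ ℓ b ℓ (ℕ.≤-trans (ℕ.+-monoˡ-≤ b ℓ≤a) a+b≤ℓ+ℓ)) ℓ≤b

module _ {n} {Ĝ : EdgeList n} {r : Fin n} {Term : Subset n} {ℓ : ℕ}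
         (rc : RootedConnected Ĝ r Term ℓ) where

  deficient-uncross : ∀ {A B t} → Deficient Ĝ r Term ℓ A → Deficient Ĝ r Term ℓ B →
    t ∈ A → t ∈ B → t ∈ Term → Deficient Ĝ r Term ℓ (A ∩ B) × Deficient Ĝ r Term ℓ (A ∪ B)
  deficient-uncross {A} {B} {t} (r∉A , _ , δA≡ℓ) (r∉B , _ , δB≡ℓ) t∈A t∈B t∈T =
    (r∉A∩B , (t , t∈A∩B , t∈T) , proj₂ δ≡ℓ) , (r∉A∪B , (t , t∈A∪B , t∈T) , proj₁ δ≡ℓ)
    where
      t∈A∩B = x∈p∩q⁺ (t∈A , t∈B)
      t∈A∪B = p⊆p∪q B t∈A
      r∉A∩B : r ∉ A ∩ B
      r∉A∩B = r∉A ∘ proj₁ ∘ x∈p∩q⁻ A B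
      r∉A∪B : r ∉ A ∪ B
      r∉A∪B = [ r∉A , r∉B ]′ ∘ x∈p∪q⁻ A B
      δ≡ℓ = squeeze-+
        (subst₂ (λ a b → _ ℕ.≤ a ℕ.+ b) δA≡ℓ δB≡ℓ (δin-length-submodular Ĝ A B))
        (rootedConnected⇒ℓ≤δin rc r∉A∪B t∈A∪B t∈T)
        (rootedConnected⇒ℓ≤δin rc r∉A∩B t∈A∩B t∈T)

  core⊆deficient : ∀ {C A t} → Core Ĝ r Term ℓ C → Deficient Ĝ r Term ℓ A →
    t ∈ C → t ∈ A → t ∈ Term → C ⊆ A
  core⊆deficient {C} {A} (deficientC , minimal) deficientA t∈C t∈A t∈T v∈C =
    proj₂ (x∈p∩q⁻ C A (subst (_ ∈_) (sym C∩A≡C) v∈C))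
    where
      C∩A≡C = minimal (C ∩ A) (proj₁ (deficient-uncross deficientC deficientA t∈C t∈A t∈T)) (p∩q⊆p C A)

  module _ {C : Subset n} (core : Core Ĝ r Term ℓ C) where

    private
      IsHalo = Halo Ĝ r Term ℓ C

    C∈Halo : IsHalo C
    C∈Halo = proj₁ core , id , λ C' core' C'⊆C → proj₂ core C' (proj₁ core') C'⊆C

    halo-uncross : ∀ {A B} → IsHalo A → IsHalo B →
      Deficient Ĝ r Term ℓ (A ∩ B) × Deficient Ĝ r Term ℓ (A ∪ B)
    halo-uncross (deficientA , C⊆A , _) (deficientB , C⊆B , _) with proj₁ core
    ... | _ , (t , t∈C , t∈T) , _ = deficient-uncross deficientA deficientB (C⊆A t∈C) (C⊆B t∈C) t∈T

    halo-∩ : ∀ {A B} → IsHalo A → IsHalo B → IsHalo (A ∩ B)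
    halo-∩ {A} {B} haloA@(_ , C⊆A , onlyA) haloB@(_ , C⊆B , _) =
      proj₁ (halo-uncross haloA haloB) ,
      (λ v∈C → x∈p∩q⁺ (C⊆A v∈C , C⊆B v∈C)) ,
      λ C' core' C'⊆A∩B → onlyA C' core' (proj₁ ∘ x∈p∩q⁻ A B ∘ C'⊆A∩B)

    halo-∪ : ∀ {A B} → IsHalo A → IsHalo B → IsHalo (A ∪ B)
    halo-∪ {A} {B} haloA@(deficientA , C⊆A , onlyA) haloB@(deficientB , _ , onlyB) =
      proj₂ (halo-uncross haloA haloB) , p⊆p∪q B ∘ C⊆A , only
      where
        only : ∀ C' → Core Ĝ r Term ℓ C' → C' ⊆ A ∪ B → C' ≡ C
        only C' core'@((_ , (t , t∈C' , t∈T) , _) , _) C'⊆A∪B with x∈p∪q⁻ A B (C'⊆A∪B t∈C')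
        ... | inj₁ t∈A = onlyA C' core' (core⊆deficient core' deficientA t∈C' t∈A t∈T)
        ... | inj₂ t∈B = onlyB C' core' (core⊆deficient core' deficientB t∈C' t∈B t∈T)

∪-closed∋union : ∀ {n} {P : Subset n → Set} → (∀ {A B} → P A → P B → P (A ∪ B)) →
  ∀ {C} → P C → ∀ H → (∀ v → v ∈ H → Σ (Subset n) λ U → P U × v ∈ U) → (∀ {U} → P U → U ⊆ H) → P H
∪-closed∋union {n} {P} P-∪ {C} PC H covered P⊆H =
  let W , PW , covers = cover (allFin n) in subst P (⊆-antisym (P⊆H PW) (covers (∈-allFin _))) PW
  where
    cover : ∀ vs → Σ (Subset n) λ W → P W × (∀ {v} → v ∈ₗ vs → v ∈ H → v ∈ W)
    cover []       = C , PC , λ ()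
    cover (v ∷ vs) with cover vs | v ∈? H
    ... | W , PW , covers | no v∉H =
            W , PW , λ { (here refl) v∈H → ⊥-elim (v∉H v∈H) ; (there v∈vs) → covers v∈vs }
    ... | W , PW , covers | yes v∈H with covered v v∈H
    ...   | U , PU , v∈U =
            W ∪ U , P-∪ PW PU , λ { (here refl) _ → q⊆p∪q W U v∈U ; (there v∈vs) v∈H → p⊆p∪q U (covers v∈vs v∈H) }

-- Minimal fractional covers of a lattice of sets

module MinimalCover {n} (E : EdgeList n) (P : Subset n → Set)
  (P-∪ : ∀ {A B} → P A → P B → P (A ∪ B)) (P-∩ : ∀ {A B} → P A → P B → P (A ∩ B))
  (x : EdgeId E → ℚ) (0≤x : ∀ e → 0ℚ ≤ x e) (covers : ∀ {U} → P U → 1ℚ ≤ inSum E x U)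
  (minimal : ∀ e → 0ℚ < x e → ∀ q → 0ℚ ≤ q → q < x e →
               Σ (Subset n) λ U → P U × inSum E (updateAt x e q) U < 1ℚ)
  where

  open ≤-Reasoning

  tight-entering : ∀ e → 0ℚ < x e → ∀ q → 0ℚ ≤ q → q < x e →
    Σ (Subset n) λ U → P U × Enters E U e × inSum E x U + q < 1ℚ + x e
  tight-entering e 0<xe q 0≤q q<xe with minimal e 0<xe q 0≤q q<xe
  ... | U , PU , violated with enters? E U e
  ...   | no  e∉δU = ⊥-elim (<-irrefl refl (begin-strict
          1ℚ                            ≤⟨ covers PU ⟩
          inSum E x U                   ≡⟨ sym (sumℚ-updateAt-∉ x e q (δin E U) (e∉δU ∘ ∈-δin⁻ E)) ⟩
          inSum E (updateAt x e q) U    <⟨ violated ⟩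
          1ℚ                            ∎))
  ...   | yes e∈δU = U , PU , e∈δU , (begin-strict
          inSum E x U + q
            ≡⟨ sym (sumℚ-updateAt-∈ x e q (δin-unique E U) (∈-δin⁺ E e∈δU)) ⟩
          inSum E (updateAt x e q) U + x e  <⟨ +-monoˡ-< (x e) violated ⟩
          1ℚ + x e                          ∎)

  nearly-tight-entering : ∀ e → 0ℚ < x e → ∀ ε → 0ℚ < ε →
    Σ (Subset n) λ U → P U × Enters E U e × inSum E x U < 1ℚ + ε
  nearly-tight-entering e 0<xe ε 0<ε with ∃-below-within 0<xe 0<ε
  ... | q , 0≤q , q<xe , xe≤q+ε with tight-entering e 0<xe q 0≤q q<xe
  ...   | U , PU , e∈δU , tight = U , PU , e∈δU , +-cancelʳ-< q (begin-strict
          inSum E x U + q   <⟨ tight ⟩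
          1ℚ + x e          ≤⟨ +-monoʳ-≤ 1ℚ xe≤q+ε ⟩
          1ℚ + (q + ε)      ≡⟨ rearrange 1ℚ q ε ⟩
          (1ℚ + ε) + q      ∎)
    where
      open +-*-Solver
      rearrange : ∀ a b c → a + (b + c) ≡ (a + c) + b
      rearrange = solve 3 (λ a b c → a :+ (b :+ c) := (a :+ c) :+ b) refl

  ∪-excess : ∀ {A B a b} → P A → P B → inSum E x A < 1ℚ + a → inSum E x B < 1ℚ + b →
    inSum E x (A ∪ B) < 1ℚ + (a + b)
  ∪-excess {A} {B} {a} {b} PA PB A<1+a B<1+b = +-cancelʳ-< 1ℚ (begin-strict
    inSum E x (A ∪ B) + 1ℚ                   ≤⟨ +-monoʳ-≤ (inSum E x (A ∪ B)) (covers (P-∩ PA PB)) ⟩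
    inSum E x (A ∪ B) + inSum E x (A ∩ B)    ≤⟨ inSum-submodular E A B x 0≤x ⟩
    inSum E x A + inSum E x B                <⟨ +-mono-<-≤ A<1+a (<⇒≤ B<1+b) ⟩
    (1ℚ + a) + (1ℚ + b)                      ≡⟨ rearrange 1ℚ a b ⟩
    (1ℚ + (a + b)) + 1ℚ                      ∎)
    where
      open +-*-Solver
      rearrange : ∀ o a b → (o + a) + (o + b) ≡ (o + (a + b)) + o
      rearrange = solve 3 (λ o a b → (o :+ a) :+ (o :+ b) := (o :+ (a :+ b)) :+ o) refl

  module _ (H : Subset n) (P⊆H : ∀ {U} → P U → U ⊆ H) where

    Active : EdgeId E → Set
    Active e = Enters E H e × 0ℚ < x e

    Absorbs : Subset n → List (EdgeId E) → Set
    Absorbs W es = ∀ {e} → e ∈ₗ es → Active e → hd E e ∈ W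

    Absorbed : ℚ → List (EdgeId E) → Set
    Absorbed ε es = Σ (Subset n) λ W → P W × inSum E x W < 1ℚ + ε × Absorbs W es

    absorb : ∀ es ε → 0ℚ < ε → (∀ {e} → e ∈ₗ es → ¬ Active e) ⊎ Absorbed ε es
    absorb []       ε 0<ε = inj₁ λ ()
    absorb (e ∷ es) ε 0<ε with enters? E H e ×-dec (0ℚ <? x e)
    ... | no  inactive = skip (absorb es ε 0<ε)
      where
        skip : (∀ {f} → f ∈ₗ es → ¬ Active f) ⊎ Absorbed ε es →
               (∀ {f} → f ∈ₗ e ∷ es → ¬ Active f) ⊎ Absorbed ε (e ∷ es)
        skip (inj₁ none) = inj₁ λ { (here refl) → inactive ; (there f∈es) → none f∈es }
        skip (inj₂ (W , PW , W<1+ε , absorbs)) =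
          inj₂ (W , PW , W<1+ε ,
                λ { (here refl) active → ⊥-elim (inactive active) ; (there f∈es) → absorbs f∈es })
    ... | yes (_ , 0<xe) = inj₂ (add (absorb es (ε * ½) (half-pos 0<ε)))
      where
        add : (∀ {f} → f ∈ₗ es → ¬ Active f) ⊎ Absorbed (ε * ½) es → Absorbed ε (e ∷ es)
        add (inj₁ none) = let U , PU , e∈δU , U<1+ε = nearly-tight-entering e 0<xe ε 0<ε in
          U , PU , U<1+ε ,
          λ { (here refl) _ → proj₁ e∈δU ; (there f∈es) active → ⊥-elim (none f∈es active) }
        add (inj₂ (W , PW , W<1+ε/2 , absorbs)) =
          let U , PU , e∈δU , U<1+ε/2 = nearly-tight-entering e 0<xe (ε * ½) (half-pos 0<ε) in
          W ∪ U , P-∪ PW PU ,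
          subst (λ δ → inSum E x (W ∪ U) < 1ℚ + δ) (half+half ε)
                (∪-excess {a = ε * ½} {b = ε * ½} PW PU W<1+ε/2 U<1+ε/2) ,
          λ { (here refl) _ → q⊆p∪q W U (proj₁ e∈δU) ; (there f∈es) active → p⊆p∪q U (absorbs f∈es active) }

    inSum<1+ε : ∀ ε → 0ℚ < ε → inSum E x H < 1ℚ + ε
    inSum<1+ε ε 0<ε with absorb (allFin (length E)) ε 0<ε
    ... | inj₁ none = begin-strict
          inSum E x H   ≤⟨ inSum-nonPos E (λ e∈δH 0<xe → none (∈-allFin _) (e∈δH , 0<xe)) ⟩
          0ℚ            <⟨ +-mono-<-≤ 0<1 (<⇒≤ 0<ε) ⟩
          1ℚ + ε        ∎
    ... | inj₂ (W , PW , W<1+ε , absorbs) = begin-strict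
          inSum E x H   ≤⟨ inSum-mono-support E 0≤x (λ e∈δH 0<xe →
                             absorbs (∈-allFin _) (e∈δH , 0<xe) , proj₂ e∈δH ∘ P⊆H PW) ⟩
          inSum E x W   <⟨ W<1+ε ⟩
          1ℚ + ε        ∎

    inSum≤1 : inSum E x H ≤ 1ℚ
    inSum≤1 = <+ε⇒≤ inSum<1+ε

lemma14 : ∀ {n} (Ĝ E₊ : EdgeList n) (r : Fin n) (Term : Subset n) (ℓ : ℕ)
    → r ∉ Term
    → RootedConnected Ĝ r Term ℓ
    → (C : Subset n) → Core Ĝ r Term ℓ C
    → (H : Subset n) → IsHaloUnion Ĝ r Term ℓ C H
    → (x : EdgeId E₊ → ℚ) → MinimalFracCoverHalo Ĝ E₊ r Term ℓ C x
    → inSum E₊ x H ≡ 1ℚ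
      × (∀ (E' : Subset (length E₊)) → IsIndicator E' x
           → length (filter (_∈? E') (δin E₊ H)) ≡ 1)
lemma14 Ĝ E₊ r Term ℓ _ rc C core H H-union x (unit-cube , covers , minimal) =
  H-tight ,
  λ E' indicator → fromℕ-injective (trans (sym (sumℚ-indicator E' indicator (δin E₊ H))) H-tight)
  where
    halo⊆H : ∀ {U} → Halo Ĝ r Term ℓ C U → U ⊆ H
    halo⊆H haloU v∈U = proj₂ (H-union _) _ haloU v∈U

    H∈Halo : Halo Ĝ r Term ℓ C H
    H∈Halo = ∪-closed∋union (halo-∪ rc core) (C∈Halo rc core) H (λ v → proj₁ (H-union v)) halo⊆H

    H-tight : inSum E₊ x H ≡ 1ℚ
    H-tight = ≤-antisym
      (MinimalCover.inSum≤1 E₊ (Halo Ĝ r Term ℓ C) (halo-∪ rc core) (halo-∩ rc core)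
         x (proj₁ ∘ unit-cube) (covers _) minimal H halo⊆H)
      (covers H H∈Halo)
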